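{- Let $n\ge 3$ and $1\le k\le n-2$. Write the polynomial $P^{n,k}(r)$ as a sum of monomials $\pm r^{e}$ with distinct exponents. Then every exponent of a monomial with positive coefficient is strictly larger than every exponent of a monomial with negative coefficient. More precisely, if $a_k$ denotes the smallest exponent carrying a positive coefficient and $b_1$ the largest exponent carrying a negative coefficient, then $a_k-b_1=n-k\ge 1$.
   Context: For an integer $n\ge 2$ let $N=\binom{n}{2}$. The edges $(i,j)$, $1\le i<j\le n$, of $K_n$ are ordered lexicographically $(1,2),(1,3),\dots,(1,n),(2,3),\dots,(n-1,n)$; $(i,j)$ has index $\mathrm{idx}(i,j)=(i-1)n-\binom{i}{2}+(j-i)$. For a binary string $\mathbf{x}=(x_1,\dots,x_n)$, the cut vector $\delta(\mathbf{x})\in\{0,1\}^N$ has entry $1$ at position $\mathrm{idx}(i,j)$ iff $x_i\ne x_j$. For $\delta\in\{0,1\}^N$ and a variable $r$, $W^n(\delta;r)=\sum_{i=1}^N\delta_i r^{N-i}$. For $1\le k\le n$, $C_k=\delta(1^k0^{n-k})$ ($k$ ones followed by $n-k$ zeros). For $1\le k\le n-1$, $P^{n,k}(r)=W^n(C_k;r)-W^n(C_{k+1};r)$. -}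

module Defs where

open import Data.Nat using (ℕ; zero; suc; _∸_; _<ᵇ_; _≡ᵇ_)
open import Data.Integer using (ℤ; +_; _-_; _+_)
open import Data.Bool using (Bool; true; false; if_then_else_; _xor_; _∧_)
open import Data.Fin using (Fin; toℕ)
open import Data.List using (List; []; _∷_; [_]; concatMap; map; length; allFin)
open import Data.Product using (_×_; _,_)

-- Edges (i,j), i<j, of K_n listed lexicographically (vertices 0-indexed as Fin n;
-- vertex i : Fin n corresponds to the paper's vertex toℕ i + 1).
edges : (n : ℕ) → List (Fin n × Fin n)
edges n = concatMap (λ i → concatMap (λ j → if toℕ i <ᵇ toℕ j then [ (i , j) ] else []) (allFin n)) (allFin n)

cutVec : {n : ℕ} → (Fin n → Bool) → List Bool
cutVec {n} x = map (λ { (i , j) → x i xor x j }) (edges n)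

-- C_k = δ(1^k 0^(n-k)): the paper's x_i = 1 iff i ≤ k, i.e. (0-indexed) toℕ i < k.
C : (n k : ℕ) → List Bool
C n k = cutVec {n} (λ i → toℕ i <ᵇ k)

-- Polynomials in r with integer coefficients, given by their coefficient function
-- (coefficient of r^e).
Poly : Set
Poly = ℕ → ℤ

bit : Bool → ℤ
bit true = + 1
bit false = + 0

-- W(δ; r) = Σ_{i=1}^{N} δ_i r^{N-i}, N = length δ. The head of the list is δ_1, which
-- carries exponent N - 1 = length of the tail.
W : List Bool → Poly
W [] e = + 0
W (b ∷ bs) e = (if length bs ≡ᵇ e then bit b else + 0) + W bs e

P : (n k : ℕ) → Poly
P n k e = W (C n k) e - W (C n (suc k)) e

{-# OPTIONS --safe #-}
module Submission where

-- The coefficient of r^e in W(δ; r) is the entry of δ at the edge in position N − e, so the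
-- coefficients of P^{n,k}, read from the top, are [ij crosses C_k] − [ij crosses C_{k+1}] along
-- the edges in lexicographic order. An edge ij (i < j) crosses C_k iff i ≤ k < j, so this
-- difference is +1 on the edges (i, k+1) with i ≤ k, −1 on the edges (k+1, j), and 0 otherwise.
-- The list therefore reads: entries in {0, 1} ending with the +1 of (k, k+1); the n − k − 1 zeros
-- of the edges (k, j) with j > k + 1; the −1 of (k+1, k+2); then entries in {0, −1}. So the last
-- +1 and the first −1 are n − k places apart.

open import Defs
open import Data.Nat using (ℕ; zero; suc; _≤_; _<_; _∸_; _+_; _<ᵇ_; _≡ᵇ_; s≤s; z<s)
open import Data.Nat.Properties
  using ( ≤-refl; ≤-reflexive; ≤-trans; <⇒≤; <⇒≢; >⇒≢; ≤⇒≯; ≤-<-trans; <-≤-trans; n<1+n; n≤1+n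
        ; m≤m+n; m<m+n; m<n⇒m<1+n; m<n⇒0<n∸m; m≤o∸n⇒m+n≤o; m≤n⇒∃[o]m+o≡n; ≮⇒≥; +-comm; +-suc; +-identityʳ
        ; +-∸-assoc; <-trans; <-cmp; _<?_; _≟_ )
open import Data.Integer using (ℤ; +_; -[1+_]; +<+; -<+) renaming (_<_ to _<ℤ_; _-_ to _-ℤ_)
import Data.Integer.Properties as ℤ
open import Data.Bool using (Bool; true; false; if_then_else_; _xor_)
open import Data.Bool.Properties using (if-float)
open import Data.Fin using (Fin; toℕ)
open import Data.List using (List; []; _∷_; [_]; _++_; _∷ʳ_; map; concat; concatMap; length; applyUpTo; tabulate; allFin)
open import Data.List.Properties
  using ( length-map; length-++; length-++-≤ʳ; length-applyUpTo; ++-assoc; concat-++; concat-map-[_]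
        ; map-concatMap; concatMap-cong; map-tabulate; map-applyUpTo; applyUpTo-∷ʳ )
open import Data.List.Relation.Unary.All using (All; []; _∷_)
open import Data.List.Relation.Unary.All.Properties using (++⁺; concat⁺; applyUpTo⁺₁; applyUpTo⁺₂)
open import Data.Product using (Σ; _×_; _,_)
open import Data.Sum using (_⊎_; inj₁; inj₂)
open import Function using (_∘_)
open import Relation.Binary.Definitions using (tri<; tri≈; tri>)
open import Relation.Nullary using (yes; no)
open import Relation.Nullary.Decidable using (dec-true; dec-false)
open import Relation.Binary.PropositionalEquality
  using (_≡_; _≢_; refl; sym; trans; cong; cong₂; subst; module ≡-Reasoning)

private
  variable
    A : Set

<ᵇ-true : ∀ {m n} → m < n → (m <ᵇ n) ≡ true
<ᵇ-true {m} {n} = dec-true (m <? n)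

<ᵇ-false : ∀ {m n} → n ≤ m → (m <ᵇ n) ≡ false
<ᵇ-false {m} {n} n≤m = dec-false (m <? n) (≤⇒≯ n≤m)

≡ᵇ-refl : ∀ m → (m ≡ᵇ m) ≡ true
≡ᵇ-refl m = dec-true (m ≟ m) refl

≡ᵇ-false : ∀ {m n} → m ≢ n → (m ≡ᵇ n) ≡ false
≡ᵇ-false {m} {n} = dec-false (m ≟ n)

+-≡ᵇ : ∀ c {m n} → (c + m ≡ᵇ c + n) ≡ (m ≡ᵇ n)
+-≡ᵇ zero    = refl
+-≡ᵇ (suc c) = +-≡ᵇ c

n∸m≡1+n∸[1+m] : ∀ {m n} → m < n → n ∸ m ≡ suc (n ∸ suc m)
n∸m≡1+n∸[1+m] {m} {n} m<n = +-∸-assoc 1 {n} {suc m} m<n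

applyUpTo-split : ∀ (f : ℕ → A) {m n} → m < n →
                  applyUpTo f n ≡ applyUpTo f m ++ f m ∷ applyUpTo (λ t → f (suc m + t)) (n ∸ suc m)
applyUpTo-split f {zero}  {suc n} _         = refl
applyUpTo-split f {suc m} {suc n} (s≤s m<n) = cong (f 0 ∷_) (applyUpTo-split (f ∘ suc) m<n)

tabulate-toℕ : ∀ (f : ℕ → A) n → tabulate {n = n} (f ∘ toℕ) ≡ applyUpTo f n
tabulate-toℕ f zero    = refl
tabulate-toℕ f (suc n) = cong (f 0 ∷_) (tabulate-toℕ (f ∘ suc) n)

concatMap-allFin : ∀ (g : ℕ → List A) n → concatMap (g ∘ toℕ) (allFin n) ≡ concat (applyUpTo g n)
concatMap-allFin g n = cong concat (trans (map-tabulate (λ i → i) (g ∘ toℕ)) (tabulate-toℕ g n))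

concat-applyUpTo-[_] : ∀ (g : ℕ → A) n → concat (applyUpTo (λ j → [ g j ]) n) ≡ applyUpTo g n
concat-applyUpTo-[ g ] n = trans (cong concat (sym (map-applyUpTo g [_] n))) (concat-map-[ applyUpTo g n ])

fromCoeffs : List ℤ → Poly
fromCoeffs []       e = + 0
fromCoeffs (z ∷ zs) e = if length zs ≡ᵇ e then z else fromCoeffs zs e

fromCoeffs-≥ : ∀ zs {e} → length zs ≤ e → fromCoeffs zs e ≡ + 0
fromCoeffs-≥ []       _    = refl
fromCoeffs-≥ (z ∷ zs) zs<e rewrite ≡ᵇ-false (<⇒≢ zs<e) = fromCoeffs-≥ zs (<⇒≤ zs<e)

W-≥ : ∀ bs {e} → length bs ≤ e → W bs e ≡ + 0
W-≥ []       _    = refl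
W-≥ (b ∷ bs) bs<e rewrite ≡ᵇ-false (<⇒≢ bs<e) | W-≥ bs (<⇒≤ bs<e) = refl

W-map-∸ : ∀ (f g : A → Bool) xs e →
          W (map f xs) e -ℤ W (map g xs) e ≡ fromCoeffs (map (λ x → bit (f x) -ℤ bit (g x)) xs) e
W-map-∸ f g []       e = refl
W-map-∸ f g (x ∷ xs) e
  rewrite length-map f xs | length-map g xs | length-map (λ x → bit (f x) -ℤ bit (g x)) xs
  with length xs ≟ e
... | yes refl
  rewrite ≡ᵇ-refl (length xs)
        | W-≥ (map f xs) (≤-reflexive (length-map f xs)) | W-≥ (map g xs) (≤-reflexive (length-map g xs))
        | ℤ.+-identityʳ (bit (f x)) | ℤ.+-identityʳ (bit (g x)) = refl
... | no xs≢e
  rewrite ≡ᵇ-false xs≢e | ℤ.+-identityˡ (W (map f xs) e) | ℤ.+-identityˡ (W (map g xs) e) = W-map-∸ f g xs e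

fromCoeffs-++-< : ∀ xs {ys e} → e < length ys → fromCoeffs (xs ++ ys) e ≡ fromCoeffs ys e
fromCoeffs-++-< []       e<ys = refl
fromCoeffs-++-< (x ∷ xs) {ys} e<ys
  rewrite ≡ᵇ-false (>⇒≢ (<-≤-trans e<ys (length-++-≤ʳ ys {xs}))) = fromCoeffs-++-< xs e<ys

fromCoeffs-++-+ : ∀ xs ys e → fromCoeffs (xs ++ ys) (length ys + e) ≡ fromCoeffs xs e
fromCoeffs-++-+ []       ys e = fromCoeffs-≥ ys (m≤m+n _ e)
fromCoeffs-++-+ (x ∷ xs) ys e = cong₂ (λ c z → if c then x else z) same-test (fromCoeffs-++-+ xs ys e)
  where
  same-test : (length (xs ++ ys) ≡ᵇ length ys + e) ≡ (length xs ≡ᵇ e)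
  same-test = trans (cong (_≡ᵇ length ys + e) (trans (length-++ xs) (+-comm (length xs) _))) (+-≡ᵇ (length ys))

fromCoeffs-++-∷ : ∀ xs y ys → fromCoeffs (xs ++ y ∷ ys) (length ys) ≡ y
fromCoeffs-++-∷ xs y ys =
  trans (fromCoeffs-++-< xs (n<1+n _))
        (cong (λ c → if c then y else fromCoeffs ys (length ys)) (≡ᵇ-refl (length ys)))

fromCoeffs-All : ∀ {P : ℤ → Set} {zs} → All P zs → P (+ 0) → ∀ e → P (fromCoeffs zs e)
fromCoeffs-All                []         p₀ e = p₀
fromCoeffs-All {zs = _ ∷ zs} (pz ∷ pzs) p₀ e with length zs ≡ᵇ e
... | true  = pz
... | false = fromCoeffs-All pzs p₀ e

fromCoeffs-++-∀ : ∀ {R : ℕ → ℤ → Set} xs ys →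
                  (∀ e → e < length ys → R e (fromCoeffs ys e)) →
                  (∀ d → R (length ys + d) (fromCoeffs xs d)) →
                  ∀ e → R e (fromCoeffs (xs ++ ys) e)
fromCoeffs-++-∀ {R = R} xs ys low high e with e <? length ys
... | yes e<ys = subst (R e) (sym (fromCoeffs-++-< xs e<ys)) (low e e<ys)
... | no  e≮ys with m≤n⇒∃[o]m+o≡n (≮⇒≥ e≮ys)
...   | d , refl = subst (R _) (sym (fromCoeffs-++-+ xs ys d)) (high d)

data SignBounded (a b e : ℕ) : ℤ → Set where
  vanish   : SignBounded a b e (+ 0)
  plusOne  : a ≤ e → SignBounded a b e (+ 1)
  minusOne : e ≤ b → SignBounded a b e -[1+ 0 ]

signBounded⇒0±1 : ∀ {a b e z} → SignBounded a b e z → z ≡ + 0 ⊎ z ≡ + 1 ⊎ z ≡ -[1+ 0 ]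
signBounded⇒0±1 vanish       = inj₁ refl
signBounded⇒0±1 (plusOne _)  = inj₂ (inj₁ refl)
signBounded⇒0±1 (minusOne _) = inj₂ (inj₂ refl)

positive⇒a≤e : ∀ {a b e z} → SignBounded a b e z → + 0 <ℤ z → a ≤ e
positive⇒a≤e vanish      (+<+ ())
positive⇒a≤e (plusOne a≤e) _ = a≤e
positive⇒a≤e (minusOne _) ()

negative⇒e≤b : ∀ {a b e z} → SignBounded a b e z → z <ℤ + 0 → e ≤ b
negative⇒e≤b vanish       (+<+ ())
negative⇒e≤b (plusOne _)  (+<+ ())
negative⇒e≤b (minusOne e≤b) _ = e≤b

ZeroOrOne ZeroOrMinusOne : ℤ → Set
ZeroOrOne      z = z ≡ + 0 ⊎ z ≡ + 1
ZeroOrMinusOne z = z ≡ + 0 ⊎ z ≡ -[1+ 0 ]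

zeroOrOne⇒signBounded : ∀ {a b e z} → a ≤ e → ZeroOrOne z → SignBounded a b e z
zeroOrOne⇒signBounded _   (inj₁ refl) = vanish
zeroOrOne⇒signBounded a≤e (inj₂ refl) = plusOne a≤e

zeroOrMinusOne⇒signBounded : ∀ {a b e z} → e ≤ b → ZeroOrMinusOne z → SignBounded a b e z
zeroOrMinusOne⇒signBounded _   (inj₁ refl) = vanish
zeroOrMinusOne⇒signBounded e≤b (inj₂ refl) = minusOne e≤b

record SignSplit (p : Poly) (d : ℕ) : Set where
  field
    a b     : ℕ
    bounded : ∀ e → SignBounded a b e (p e)
    p[a]≡1  : p a ≡ + 1
    p[b]≡-1 : p b ≡ -[1+ 0 ]
    a≡b+d   : a ≡ b + d

fromCoeffs-signSplit : ∀ {p : Poly} {xs zs ys} →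
                       (∀ e → p e ≡ fromCoeffs (xs ++ + 1 ∷ zs ++ -[1+ 0 ] ∷ ys) e) →
                       All ZeroOrOne xs → All (_≡ + 0) zs → All ZeroOrMinusOne ys →
                       SignSplit p (suc (length zs))
fromCoeffs-signSplit {p} {xs} {zs} {ys} p≗ xs∈01 zs≡0 ys∈0-1 = record
  { a       = a
  ; b       = b
  ; bounded = λ e → subst (SignBounded a b e) (sym (p≗ e)) (bounded-all e)
  ; p[a]≡1  = trans (p≗ a) (fromCoeffs-++-∷ xs (+ 1) (zs ++ -[1+ 0 ] ∷ ys))
  ; p[b]≡-1 = trans (p≗ b)
                (trans (cong (λ L → fromCoeffs L b) (sym (++-assoc xs (+ 1 ∷ zs) (-[1+ 0 ] ∷ ys))))
                       (fromCoeffs-++-∷ (xs ++ + 1 ∷ zs) -[1+ 0 ] ys))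
  ; a≡b+d   = trans (length-++ zs) (trans (+-comm (length zs) _) (sym (+-suc (length ys) _)))
  }
  where
  a = length (zs ++ -[1+ 0 ] ∷ ys)
  b = length ys
  bounded-last : ∀ e → SignBounded a b e (fromCoeffs (-[1+ 0 ] ∷ ys) e)
  bounded-last = fromCoeffs-++-∀ {R = SignBounded a b} [ -[1+ 0 ] ] ys
    (λ e e<b → zeroOrMinusOne⇒signBounded (<⇒≤ e<b) (fromCoeffs-All ys∈0-1 (inj₁ refl) e))
    λ { zero → minusOne (≤-reflexive (+-identityʳ b)) ; (suc _) → vanish }
  bounded-zs : ∀ e → SignBounded a b e (fromCoeffs (zs ++ -[1+ 0 ] ∷ ys) e)
  bounded-zs = fromCoeffs-++-∀ {R = SignBounded a b} zs (-[1+ 0 ] ∷ ys) (λ e _ → bounded-last e)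
    λ d → subst (SignBounded a b _) (sym (fromCoeffs-All {P = _≡ + 0} zs≡0 refl d)) vanish
  bounded-first : ∀ e → SignBounded a b e (fromCoeffs (+ 1 ∷ zs ++ -[1+ 0 ] ∷ ys) e)
  bounded-first = fromCoeffs-++-∀ {R = SignBounded a b} [ + 1 ] (zs ++ -[1+ 0 ] ∷ ys)
    (λ e _ → bounded-zs e)
    λ { zero → plusOne (≤-reflexive (sym (+-identityʳ a))) ; (suc _) → vanish }
  bounded-all : ∀ e → SignBounded a b e (fromCoeffs (xs ++ + 1 ∷ zs ++ -[1+ 0 ] ∷ ys) e)
  bounded-all = fromCoeffs-++-∀ {R = SignBounded a b} xs (+ 1 ∷ zs ++ -[1+ 0 ] ∷ ys)
    (λ e _ → bounded-first e)
    λ d → zeroOrOne⇒signBounded (≤-trans (n≤1+n a) (m≤m+n _ d)) (fromCoeffs-All xs∈01 (inj₁ refl) d)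

row : (ℕ → ℕ → A) → ℕ → ℕ → List A
row f n i = applyUpTo (λ t → f i (suc i + t)) (n ∸ suc i)

row-All : ∀ {P : A → Set} (f : ℕ → ℕ → A) n i → (∀ j → i < j → P (f i j)) → All P (row f n i)
row-All f n i Pf = applyUpTo⁺₂ _ (n ∸ suc i) (λ t → Pf _ (s≤s (m≤m+n i t)))

row-∷ : ∀ (f : ℕ → ℕ → A) {n i} → suc i < n →
        row f n i ≡ f i (suc i) ∷ applyUpTo (λ t → f i (suc i + suc t)) (n ∸ suc (suc i))
row-∷ f {n} {i} 1+i<n = trans (cong (applyUpTo (λ t → f i (suc i + t))) (n∸m≡1+n∸[1+m] 1+i<n))
                              (cong (λ j → f i j ∷ applyUpTo (λ t → f i (suc i + suc t)) (n ∸ suc (suc i)))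
                                    (+-identityʳ (suc i)))

filter-row : ∀ (f : ℕ → ℕ → A) i n →
             concat (applyUpTo (λ j → if i <ᵇ j then [ f i j ] else []) n) ≡ row f n i
filter-row f i       zero    = refl
filter-row f zero    (suc n) = concat-applyUpTo-[ f 0 ∘ suc ] n
filter-row f (suc i) (suc n) = filter-row (λ i′ j → f (suc i′) (suc j)) i n

map-edges : ∀ {n} (h : Fin n × Fin n → A) (f : ℕ → ℕ → A) → (∀ i j → h (i , j) ≡ f (toℕ i) (toℕ j)) →
            map h (edges n) ≡ concat (applyUpTo (row f n) n)
map-edges {A = A} {n = n} h f h≗f = begin
    map h (edges n)
  ≡⟨ map-concatMap h _ (allFin n) ⟩
    concatMap (λ i → map h (concatMap (pairs i) (allFin n))) (allFin n)
  ≡⟨ concatMap-cong row-edges (allFin n) ⟩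
    concatMap (row f n ∘ toℕ) (allFin n)
  ≡⟨ concatMap-allFin (row f n) n ⟩
    concat (applyUpTo (row f n) n)
  ∎
  where
  open ≡-Reasoning
  pairs : Fin n → Fin n → List (Fin n × Fin n)
  pairs i j = if toℕ i <ᵇ toℕ j then [ (i , j) ] else []
  weights : ℕ → ℕ → List A
  weights i j = if i <ᵇ j then [ f i j ] else []
  row-edges : ∀ i → map h (concatMap (pairs i) (allFin n)) ≡ row f n (toℕ i)
  row-edges i = begin
      map h (concatMap (pairs i) (allFin n))
    ≡⟨ map-concatMap h (pairs i) (allFin n) ⟩
      concatMap (map h ∘ pairs i) (allFin n)
    ≡⟨ concatMap-cong (λ j → trans (if-float (map h) (toℕ i <ᵇ toℕ j))
                                   (cong (λ x → if toℕ i <ᵇ toℕ j then [ x ] else []) (h≗f i j))) (allFin n) ⟩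
      concatMap (weights (toℕ i) ∘ toℕ) (allFin n)
    ≡⟨ concatMap-allFin (weights (toℕ i)) n ⟩
      concat (applyUpTo (weights (toℕ i)) n)
    ≡⟨ filter-row f (toℕ i) n ⟩
      row f n (toℕ i)
    ∎

cut : ℕ → ℕ → ℕ → Bool
cut k i j = (i <ᵇ k) xor (j <ᵇ k)

bitDiff : Bool → Bool → ℤ
bitDiff c c′ = bit c -ℤ bit c′

cutDiff : ℕ → ℕ → ℕ → ℤ
cutDiff k i j = bitDiff (cut k i j) (cut (suc k) i j)

cut-crossing : ∀ {k i j} → i < k → k ≤ j → cut k i j ≡ true
cut-crossing i<k k≤j = cong₂ _xor_ (<ᵇ-true i<k) (<ᵇ-false k≤j)

cut-below : ∀ {k i j} → i < k → j < k → cut k i j ≡ false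
cut-below i<k j<k = cong₂ _xor_ (<ᵇ-true i<k) (<ᵇ-true j<k)

cut-above : ∀ {k i j} → k ≤ i → k ≤ j → cut k i j ≡ false
cut-above k≤i k≤j = cong₂ _xor_ (<ᵇ-false k≤i) (<ᵇ-false k≤j)

cutDiff-into : ∀ {k i} → i < k → cutDiff k i k ≡ + 1
cutDiff-into i<k = cong₂ bitDiff (cut-crossing i<k ≤-refl) (cut-below (m<n⇒m<1+n i<k) (n<1+n _))

cutDiff-out : ∀ {k j} → k < j → cutDiff k k j ≡ -[1+ 0 ]
cutDiff-out k<j = cong₂ bitDiff (cut-above ≤-refl (<⇒≤ k<j)) (cut-crossing (n<1+n _) k<j)

cutDiff-across : ∀ {k i j} → i < k → k < j → cutDiff k i j ≡ + 0
cutDiff-across i<k k<j = cong₂ bitDiff (cut-crossing i<k (<⇒≤ k<j)) (cut-crossing (m<n⇒m<1+n i<k) k<j)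

cutDiff-inside : ∀ {k i j} → i < k → j < k → cutDiff k i j ≡ + 0
cutDiff-inside i<k j<k = cong₂ bitDiff (cut-below i<k j<k) (cut-below (m<n⇒m<1+n i<k) (m<n⇒m<1+n j<k))

cutDiff-beyond : ∀ {k i j} → k < i → i < j → cutDiff k i j ≡ + 0
cutDiff-beyond k<i i<j =
  cong₂ bitDiff (cut-above (<⇒≤ k<i) (<⇒≤ (<-trans k<i i<j))) (cut-above k<i (<-trans k<i i<j))

cutDiff-zeroOrOne : ∀ {k i j} → i < k → ZeroOrOne (cutDiff k i j)
cutDiff-zeroOrOne {k} {i} {j} i<k with <-cmp j k
... | tri< j<k _ _ = inj₁ (cutDiff-inside i<k j<k)
... | tri≈ _ refl _ = inj₂ (cutDiff-into i<k)
... | tri> _ _ k<j = inj₁ (cutDiff-across i<k k<j)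

P≗fromCoeffs : ∀ n k e → P n k e ≡ fromCoeffs (concat (applyUpTo (row (cutDiff k) n) n)) e
P≗fromCoeffs n k e = trans (W-map-∸ _ _ (edges n) e)
                           (cong (λ L → fromCoeffs L e) (map-edges {n = n} _ (cutDiff k) (λ _ _ → refl)))

P-signSplit : ∀ {n k} → 1 ≤ k → suc k < n → SignSplit (P n k) (n ∸ k)
P-signSplit {n} {k@(suc k₀)} (s≤s _) 1+k<n =
  subst (SignSplit (P n k)) |Z|≡n∸k
        (fromCoeffs-signSplit (λ e → trans (P≗fromCoeffs n k e) (cong (λ L → fromCoeffs L e) rows-shape))
                              X∈01 Z≡0 (++⁺ Y∈0-1 Rest∈0-1))
  where
  open ≡-Reasoning
  D = cutDiff k
  R = row D n
  k<n = <-trans (n<1+n k) 1+k<n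
  X = concat (applyUpTo R k₀)
  Z = applyUpTo (λ t → D k₀ (k + suc t)) (n ∸ suc k)
  Y = applyUpTo (λ t → D k (suc k + suc t)) (n ∸ suc (suc k))
  Rs = applyUpTo (λ t → R (suc k + t)) (n ∸ suc k)

  -- Vertices are 0-indexed: the +1 is on the edge (k₀ , k), which is the paper's (k, k+1).
  rows-shape : concat (applyUpTo R n) ≡ X ++ + 1 ∷ Z ++ -[1+ 0 ] ∷ Y ++ concat Rs
  rows-shape = begin
      concat (applyUpTo R n)
    ≡⟨ cong concat (applyUpTo-split R k<n) ⟩
      concat (applyUpTo R k ++ R k ∷ Rs)
    ≡⟨ cong (λ rs → concat (rs ++ R k ∷ Rs)) (sym (applyUpTo-∷ʳ R k₀)) ⟩
      concat ((applyUpTo R k₀ ∷ʳ R k₀) ++ R k ∷ Rs)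
    ≡⟨ cong concat (++-assoc (applyUpTo R k₀) [ R k₀ ] (R k ∷ Rs)) ⟩
      concat (applyUpTo R k₀ ++ R k₀ ∷ R k ∷ Rs)
    ≡⟨ sym (concat-++ (applyUpTo R k₀) (R k₀ ∷ R k ∷ Rs)) ⟩
      X ++ R k₀ ++ R k ++ concat Rs
    ≡⟨ cong₂ (λ r r′ → X ++ r ++ r′ ++ concat Rs) (row-∷ D k<n) (row-∷ D 1+k<n) ⟩
      X ++ D k₀ k ∷ Z ++ D k (suc k) ∷ Y ++ concat Rs
    ≡⟨ cong₂ (λ x y → X ++ x ∷ Z ++ y ∷ Y ++ concat Rs) (cutDiff-into (n<1+n k₀)) (cutDiff-out (n<1+n k)) ⟩
      X ++ + 1 ∷ Z ++ -[1+ 0 ] ∷ Y ++ concat Rs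
    ∎

  X∈01 : All ZeroOrOne X
  X∈01 = concat⁺ (applyUpTo⁺₁ R k₀ λ i<k₀ → row-All D n _ λ j _ → cutDiff-zeroOrOne {j = j} (m<n⇒m<1+n i<k₀))

  Z≡0 : All (_≡ + 0) Z
  Z≡0 = applyUpTo⁺₂ _ _ λ t → cutDiff-across (n<1+n k₀) (m<m+n k z<s)

  Y∈0-1 : All ZeroOrMinusOne Y
  Y∈0-1 = applyUpTo⁺₂ _ _ λ t → inj₂ (cutDiff-out (s≤s (m≤m+n k (suc t))))

  Rest∈0-1 : All ZeroOrMinusOne (concat Rs)
  Rest∈0-1 = concat⁺ (applyUpTo⁺₂ _ (n ∸ suc k) λ t →
               row-All D n _ λ _ i<j → inj₁ (cutDiff-beyond (s≤s (m≤m+n k t)) i<j))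

  |Z|≡n∸k : suc (length Z) ≡ n ∸ k
  |Z|≡n∸k = trans (cong suc (length-applyUpTo _ (n ∸ suc k))) (sym (n∸m≡1+n∸[1+m] k<n))

mainTheorem3 : (n k : ℕ) → 3 ≤ n → 1 ≤ k → k ≤ n ∸ 2 →
    ((e : ℕ) → (P n k e ≡ + 0 ⊎ P n k e ≡ + 1 ⊎ P n k e ≡ -[1+ 0 ]))
    × ((e e′ : ℕ) → + 0 <ℤ P n k e → P n k e′ <ℤ + 0 → e′ < e)
    × Σ ℕ (λ a → Σ ℕ (λ b →
        (+ 0 <ℤ P n k a × ((e : ℕ) → + 0 <ℤ P n k e → a ≤ e))
        × (P n k b <ℤ + 0 × ((e : ℕ) → P n k e <ℤ + 0 → e ≤ b))
        × a ≡ b + (n ∸ k)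
        × 1 ≤ n ∸ k))
mainTheorem3 n k 3≤n 1≤k k≤n∸2 =
    (λ e → signBounded⇒0±1 (bounded e))
  , (λ e e′ 0<pₑ pₑ′<0 → ≤-<-trans (negative⇒e≤b (bounded e′) pₑ′<0)
                                    (<-≤-trans b<a (positive⇒a≤e (bounded e) 0<pₑ)))
  , a , b
  , (subst (+ 0 <ℤ_) (sym p[a]≡1) (+<+ z<s) , λ e → positive⇒a≤e (bounded e))
  , (subst (_<ℤ + 0) (sym p[b]≡-1) -<+ , λ e → negative⇒e≤b (bounded e))
  , a≡b+d
  , 0<n∸k
  where
  1+k<n : suc k < n
  1+k<n = subst (_≤ n) (+-comm k 2) (m≤o∸n⇒m+n≤o k (≤-trans (n≤1+n 2) 3≤n) k≤n∸2)
  0<n∸k : 1 ≤ n ∸ k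
  0<n∸k = m<n⇒0<n∸m (<-trans (n<1+n k) 1+k<n)
  open SignSplit (P-signSplit 1≤k 1+k<n)
  b<a : b < a
  b<a = subst (b <_) (sym a≡b+d) (m<m+n b 0<n∸k)
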